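{- Up to $\equiv_m$, the structural composition operator $\|$ on NAA over a finite alphabet $\Sigma$ is associative and commutative, distributes over disjunction $\vee$, and has unit $\mathsf U$; that is, for all NAA $S_1,S_2,S_3,S$: $(S_1\|S_2)\|S_3\equiv_m S_1\|(S_2\|S_3)$, $S_1\|S_2\equiv_m S_2\|S_1$, $S_1\|(S_2\vee S_3)\equiv_m (S_1\|S_2)\vee(S_1\|S_3)$, and $S\|\mathsf U\equiv_m S$, where $\mathsf U$ is the LTS $(\{u\},u,\to)$ with $u\xrightarrow a u$ for all $a\in\Sigma$.
   Context: A NAA is $(S,S^0,\mathrm{Tran})$, $S^0\subseteq S$ finite, $\mathrm{Tran}:S\to 2^{\mathcal P_{\mathrm{fin}}(\Sigma\times S)}$. An LTS $(I,i^0,\to)$ is identified with the NAA $(I,\{i^0\},\mathrm{Tran})$ where $\mathrm{Tran}(s)=\{\{(a,t)\mid s\xrightarrow at\}\}$. NAA modal refinement $R\subseteq S_1\times S_2$: for $(s_1,s_2)\in R$ and $M_1\in\mathrm{Tran}_1(s_1)$ there is $M_2\in\mathrm{Tran}_2(s_2)$ such that each $(a,t_1)\in M_1$ has $(a,t_2)\in M_2$ with $(t_1,t_2)\in R$ and each $(a,t_2)\in M_2$ has $(a,t_1)\in M_1$ with $(t_1,t_2)\in R$; initialised if each initial state of $S_1$ is related to some initial state of $S_2$. $S_1\le_m S_2$ iff an initialised modal refinement exists; $S_1\equiv_m S_2$ iff both $S_1\le_m S_2$ and $S_2\le_m S_1$. Disjunction: $S_1\vee S_2=(S_1\cup S_2,S_1^0\cup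 S_2^0,\mathrm{Tran}_1\cup\mathrm{Tran}_2)$ (disjoint union). Composition: $S_1\|S_2=(S_1\times S_2,S_1^0\times S_2^0,\mathrm{Tran})$ with $\mathrm{Tran}((s_1,s_2))=\{M_1\|M_2\mid M_1\in\mathrm{Tran}_1(s_1),M_2\in\mathrm{Tran}_2(s_2)\}$, where $M_1\|M_2=\{(a,(t_1,t_2))\mid(a,t_1)\in M_1,(a,t_2)\in M_2\}$. -}

module Defs where

open import Data.Nat using (ℕ)
open import Data.Fin using (Fin; _≟_)
open import Data.Fin.Base using ()
open import Data.List using (List; []; _∷_; map; concatMap; _++_; allFin)
open import Data.List.Membership.Propositional using (_∈_)
open import Data.Product using (Σ; ∃; ∃-syntax; _×_; _,_; map₂)
open import Data.Sum using (_⊎_; inj₁; inj₂)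
open import Data.Unit using (⊤; tt)
open import Relation.Binary.PropositionalEquality using (_≡_)
open import Relation.Nullary using (yes; no)

module _ (n : ℕ) where

  Act : Set
  Act = Fin n

  -- Nondeterministic acceptance automaton.  A finite subset of Σ × S is
  -- represented by a list (only membership is ever used).
  record NAA : Set₁ where
    field
      St   : Set
      Init : List St
      Tran : St → List (Act × St) → Set       -- Tran s : set of finite sets
  open NAA public

  IsModalRefinement : (A B : NAA) → (St A → St B → Set) → Set
  IsModalRefinement A B R =
    ∀ s₁ s₂ → R s₁ s₂ → ∀ M₁ → Tran A s₁ M₁ →
      ∃[ M₂ ] (Tran B s₂ M₂
        × (∀ a t₁ → (a , t₁) ∈ M₁ → ∃[ t₂ ] ((a , t₂) ∈ M₂ × R t₁ t₂))
        × (∀ a t₂ → (a , t₂) ∈ M₂ → ∃[ t₁ ] ((a , t₁) ∈ M₁ × R t₁ t₂)))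

  Initialised : (A B : NAA) → (St A → St B → Set) → Set
  Initialised A B R = ∀ s₁ → s₁ ∈ Init A → ∃[ s₂ ] (s₂ ∈ Init B × R s₁ s₂)

  _≤m_ : NAA → NAA → Set₁
  A ≤m B = Σ (St A → St B → Set) λ R → IsModalRefinement A B R × Initialised A B R

  _≡m_ : NAA → NAA → Set₁
  A ≡m B = (A ≤m B) × (B ≤m A)

  _∨_ : NAA → NAA → NAA
  A ∨ B = record
    { St   = St A ⊎ St B
    ; Init = map inj₁ (Init A) ++ map inj₂ (Init B)
    ; Tran = T
    }
    where
      T : St A ⊎ St B → List (Act × (St A ⊎ St B)) → Set
      T (inj₁ s) M = ∃[ M' ] (Tran A s M' × M ≡ map (map₂ inj₁) M')
      T (inj₂ s) M = ∃[ M' ] (Tran B s M' × M ≡ map (map₂ inj₂) M')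

  _‖M_ : {X Y : Set} → List (Act × X) → List (Act × Y) → List (Act × (X × Y))
  M₁ ‖M M₂ = concatMap (λ { (a , t₁) → concatMap (λ { (b , t₂) → pick a b t₁ t₂ }) M₂ }) M₁
    where
      pick : _ → _ → _ → _ → List _
      pick a b t₁ t₂ with a ≟ b
      ... | yes _ = (a , (t₁ , t₂)) ∷ []
      ... | no  _ = []

  _‖_ : NAA → NAA → NAA
  A ‖ B = record
    { St   = St A × St B
    ; Init = concatMap (λ s₁ → map (s₁ ,_) (Init B)) (Init A)
    ; Tran = λ { (s₁ , s₂) M → ∃[ M₁ ] ∃[ M₂ ] (Tran A s₁ M₁ × Tran B s₂ M₂ × M ≡ (M₁ ‖M M₂)) }
    }

  record LTS : Set₁ where
    field
      I    : Set
      i⁰   : I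
      succ : I → List (Act × I)
  open LTS public

  LTS→NAA : LTS → NAA
  LTS→NAA L = record
    { St   = I L
    ; Init = i⁰ L ∷ []
    ; Tran = λ s M → M ≡ succ L s
    }

  U-LTS : LTS
  U-LTS = record { I = ⊤ ; i⁰ = tt ; succ = λ _ → map (_, tt) (allFin n) }

  U : NAA
  U = LTS→NAA U-LTS

module Submission where

-- Each law is witnessed by the graph of the evident bijection of state spaces
-- (reassociation, swap, distribution of × over ⊎, projection away from the
-- unit's single state).  Transitions correspond under these bijections because
-- (a , (x , y)) lies in M₁ ‖ M₂ exactly when (a , x) ∈ M₁ and (a , y) ∈ M₂,
-- and U accepts every action, so the matching sets are images of each other.

open import Defs
open import Data.Nat using (ℕ)
open import Data.Fin using (_≟_)
open import Data.List using (List; []; _∷_; _++_; map)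
open import Data.List.Properties using (++-identityʳ)
open import Data.List.Membership.Propositional using (_∈_; find; lose)
open import Data.List.Membership.Propositional.Properties
  using (∈-++⁺ˡ; ∈-++⁺ʳ; ∈-++⁻; ∈-map⁺; ∈-map⁻; ∈-concatMap⁺; ∈-concatMap⁻; ∈-allFin)
open import Data.List.Relation.Unary.Any using (here; there)
open import Data.Product using (_×_; _,_; ∃-syntax; proj₁; map₂; swap; assocʳ′; assocˡ′)
open import Data.Sum using (_⊎_; inj₁; inj₂)
open import Data.Unit using (tt)
open import Data.Empty using (⊥-elim)
open import Relation.Binary.PropositionalEquality using (_≡_; refl; sym; subst)
open import Relation.Nullary using (yes; no)

module _ {n : ℕ} where

  private
    _⊗_ : {X Y : Set} → List (Act n × X) → List (Act n × Y) → List (Act n × (X × Y))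
    _⊗_ = _‖M_ n

    _∥_ : NAA n → NAA n → NAA n
    _∥_ = _‖_ n

    _⋎_ : NAA n → NAA n → NAA n
    _⋎_ = _∨_ n

  -- Defs matches actions in M₁ ‖M M₂ by a where-bound `pick` that cannot be
  -- named here; products with singleton factors are where its test a ≟ b
  -- surfaces in the normal form, so that `with` can split on it.
  module _ {X Y : Set} where

    ∈-‖M-singleton⁻ : ∀ {a b : Act n} {x : X} {y : Y} {c u v} →
                      (c , (u , v)) ∈ ((a , x) ∷ []) ⊗ ((b , y) ∷ []) →
                      a ≡ b × c ≡ a × u ≡ x × v ≡ y
    ∈-‖M-singleton⁻ {a} {b} m with a ≟ b
    ∈-‖M-singleton⁻ (here refl) | yes refl = refl , refl , refl , refl
    ∈-‖M-singleton⁻ ()          | no _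

    ∈-‖M⁻ : ∀ (M₁ : List (Act n × X)) (M₂ : List (Act n × Y)) {a x y} →
            (a , (x , y)) ∈ M₁ ⊗ M₂ → (a , x) ∈ M₁ × (a , y) ∈ M₂
    ∈-‖M⁻ M₁ M₂ m with find (∈-concatMap⁻ _ {xs = M₁} m)
    ... | (a , x) , x∈ , m′ with find (∈-concatMap⁻ _ {xs = M₂} m′)
    ... | (b , y) , y∈ , m″ with ∈-‖M-singleton⁻ {a} {b} {x} {y} (∈-++⁺ˡ (∈-++⁺ˡ m″))
    ... | refl , refl , refl , refl = x∈ , y∈

    ∈-‖M⁺ : ∀ (M₁ : List (Act n × X)) (M₂ : List (Act n × Y)) {a x y} →
            (a , x) ∈ M₁ → (a , y) ∈ M₂ → (a , (x , y)) ∈ M₁ ⊗ M₂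
    ∈-‖M⁺ (_ ∷ M₁) M₂ (there p) q = ∈-++⁺ʳ _ (∈-‖M⁺ M₁ M₂ p q)
    ∈-‖M⁺ (_ ∷ _)  M₂ (here refl) q = ∈-++⁺ˡ (∈-++-[]⁻ (row M₂ q))
      where
        -- The row of (a , x) is reached through the singleton ((a , x) ∷ []),
        -- whose product carries a trailing ++ [].
        ∈-++-[]⁻ : ∀ {A : Set} {v : A} {xs} → v ∈ xs ++ [] → v ∈ xs
        ∈-++-[]⁻ {xs = xs} = subst (_ ∈_) (++-identityʳ xs)

        ∈-++-[]-extendˡ : ∀ {A : Set} {v : A} {xs ys} → v ∈ ys ++ [] → v ∈ (xs ++ ys) ++ []
        ∈-++-[]-extendˡ {xs = xs} m = ∈-++⁺ˡ (∈-++⁺ʳ xs (∈-++-[]⁻ m))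

        row : ∀ {a x y} M₂ → (a , y) ∈ M₂ → (a , (x , y)) ∈ ((a , x) ∷ []) ⊗ M₂
        row (_ ∷ M₂) (there q) = ∈-++-[]-extendˡ (row M₂ q)
        row {a} (_ ∷ _) (here refl) with a ≟ a
        ... | yes refl = here refl
        ... | no a≢a   = ⊥-elim (a≢a refl)

  ∈-‖M-swap : ∀ {X Y : Set} (M₁ : List (Act n × X)) (M₂ : List (Act n × Y)) {a x y} →
              (a , (x , y)) ∈ M₁ ⊗ M₂ → (a , (y , x)) ∈ M₂ ⊗ M₁
  ∈-‖M-swap M₁ M₂ m = let p , q = ∈-‖M⁻ M₁ M₂ m in ∈-‖M⁺ M₂ M₁ q p

  module _ {X Y Z : Set}
           (M₁ : List (Act n × X)) (M₂ : List (Act n × Y)) (M₃ : List (Act n × Z)) where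

    ∈-‖M-assocʳ : ∀ {a x y z} →
                  (a , ((x , y) , z)) ∈ (M₁ ⊗ M₂) ⊗ M₃ → (a , (x , (y , z))) ∈ M₁ ⊗ (M₂ ⊗ M₃)
    ∈-‖M-assocʳ m =
      let p₁₂ , p₃ = ∈-‖M⁻ (M₁ ⊗ M₂) M₃ m
          p₁ , p₂  = ∈-‖M⁻ M₁ M₂ p₁₂
      in ∈-‖M⁺ M₁ (M₂ ⊗ M₃) p₁ (∈-‖M⁺ M₂ M₃ p₂ p₃)

    ∈-‖M-assocˡ : ∀ {a x y z} →
                  (a , (x , (y , z))) ∈ M₁ ⊗ (M₂ ⊗ M₃) → (a , ((x , y) , z)) ∈ (M₁ ⊗ M₂) ⊗ M₃
    ∈-‖M-assocˡ m =
      let p₁ , p₂₃ = ∈-‖M⁻ M₁ (M₂ ⊗ M₃) m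
          p₂ , p₃  = ∈-‖M⁻ M₂ M₃ p₂₃
      in ∈-‖M⁺ (M₁ ⊗ M₂) M₃ (∈-‖M⁺ M₁ M₂ p₁ p₂) p₃

  ∈-succ-U : ∀ a → (a , tt) ∈ succ (U-LTS n) tt
  ∈-succ-U a = ∈-map⁺ (_, tt) (∈-allFin a)

  module _ {X : Set} (M : List (Act n × X)) where

    ∈-‖M-U⁺ : ∀ {a x} → (a , x) ∈ M → (a , (x , tt)) ∈ M ⊗ succ (U-LTS n) tt
    ∈-‖M-U⁺ p = ∈-‖M⁺ M (succ (U-LTS n) tt) p (∈-succ-U _)

    ∈-‖M-U⁻ : ∀ {a x} → (a , (x , tt)) ∈ M ⊗ succ (U-LTS n) tt → (a , x) ∈ M
    ∈-‖M-U⁻ m = proj₁ (∈-‖M⁻ M (succ (U-LTS n) tt) m)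

  ∈-map₂⁻ : ∀ {X Y : Set} {f : X → Y} {M : List (Act n × X)} {a y} →
            (a , y) ∈ map (map₂ f) M → ∃[ x ] ((a , x) ∈ M × f x ≡ y)
  ∈-map₂⁻ m with ∈-map⁻ (map₂ _) m
  ... | (_ , x) , p , refl = x , p , refl

  module _ (A B : NAA n) where

    ∈-Init-‖⁻ : ∀ {s₁ s₂} → (s₁ , s₂) ∈ Init (A ∥ B) → s₁ ∈ Init A × s₂ ∈ Init B
    ∈-Init-‖⁻ m with find (∈-concatMap⁻ _ {xs = Init A} m)
    ... | s₁ , p , m′ with ∈-map⁻ (s₁ ,_) m′
    ... | s₂ , q , refl = p , q

    ∈-Init-‖⁺ : ∀ {s₁ s₂} → s₁ ∈ Init A → s₂ ∈ Init B → (s₁ , s₂) ∈ Init (A ∥ B)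
    ∈-Init-‖⁺ p q = ∈-concatMap⁺ (λ s → map (s ,_) (Init B)) (lose p (∈-map⁺ (_ ,_) q))

    ∈-Init-∨⁺ˡ : ∀ {s} → s ∈ Init A → inj₁ s ∈ Init (A ⋎ B)
    ∈-Init-∨⁺ˡ p = ∈-++⁺ˡ (∈-map⁺ inj₁ p)

    ∈-Init-∨⁺ʳ : ∀ {s} → s ∈ Init B → inj₂ s ∈ Init (A ⋎ B)
    ∈-Init-∨⁺ʳ p = ∈-++⁺ʳ (map inj₁ (Init A)) (∈-map⁺ inj₂ p)

    ∈-Init-∨⁻ˡ : ∀ {s} → inj₁ s ∈ Init (A ⋎ B) → s ∈ Init A
    ∈-Init-∨⁻ˡ m with ∈-++⁻ (map inj₁ (Init A)) m
    ... | inj₁ m′ with ∈-map⁻ inj₁ m′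
    ...   | _ , p , refl = p
    ∈-Init-∨⁻ˡ m | inj₂ m′ with ∈-map⁻ inj₂ m′
    ...   | _ , _ , ()

    ∈-Init-∨⁻ʳ : ∀ {s} → inj₂ s ∈ Init (A ⋎ B) → s ∈ Init B
    ∈-Init-∨⁻ʳ m with ∈-++⁻ (map inj₁ (Init A)) m
    ... | inj₁ m′ with ∈-map⁻ inj₁ m′
    ...   | _ , _ , ()
    ∈-Init-∨⁻ʳ m | inj₂ m′ with ∈-map⁻ inj₂ m′
    ...   | _ , p , refl = p

  IsImage : {X Y : Set} → (X → Y) → List (Act n × X) → List (Act n × Y) → Set
  IsImage f M M′ = (∀ {a x} → (a , x) ∈ M → (a , f x) ∈ M′)
                 × (∀ {a y} → (a , y) ∈ M′ → ∃[ x ] ((a , x) ∈ M × f x ≡ y))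

  isImage-byInverse : ∀ {X Y : Set} {f : X → Y} {M M′} (g : Y → X) → (∀ {y} → f (g y) ≡ y) →
                      (∀ {a x} → (a , x) ∈ M → (a , f x) ∈ M′) →
                      (∀ {a y} → (a , y) ∈ M′ → (a , g y) ∈ M) →
                      IsImage f M M′
  isImage-byInverse g f∘g≡id to from = to , λ m → g _ , from m , f∘g≡id

  record IsRefinementMap (A B : NAA n) (f : St A → St B) : Set where
    field
      init : ∀ {s} → s ∈ Init A → f s ∈ Init B
      tran : ∀ {s M} → Tran A s M → ∃[ M′ ] (Tran B (f s) M′ × IsImage f M M′)
  open IsRefinementMap

  refinementMap⇒≤m : ∀ {A B} (f : St A → St B) → IsRefinementMap A B f → _≤m_ n A B
  refinementMap⇒≤m {A} {B} f r = (λ s t → f s ≡ t) , refines , initialised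
    where
      refines : IsModalRefinement n A B (λ s t → f s ≡ t)
      refines s .(f s) refl M tr with tran r tr
      ... | M′ , tr′ , to , from = M′ , tr′ , (λ _ t m → f t , to m , refl) , (λ _ _ m → from m)

      initialised : Initialised n A B (λ s t → f s ≡ t)
      initialised s m = f s , init r m , refl

  ‖-assoc : (S₁ S₂ S₃ : NAA n) → _≡m_ n ((S₁ ∥ S₂) ∥ S₃) (S₁ ∥ (S₂ ∥ S₃))
  ‖-assoc S₁ S₂ S₃ = refinementMap⇒≤m assocʳ′ ≤-map , refinementMap⇒≤m assocˡ′ ≥-map
    where
      ≤-map : IsRefinementMap ((S₁ ∥ S₂) ∥ S₃) (S₁ ∥ (S₂ ∥ S₃)) assocʳ′
      ≤-map .init m =
        let p₁₂ , p₃ = ∈-Init-‖⁻ (S₁ ∥ S₂) S₃ m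
            p₁ , p₂  = ∈-Init-‖⁻ S₁ S₂ p₁₂
        in ∈-Init-‖⁺ S₁ (S₂ ∥ S₃) p₁ (∈-Init-‖⁺ S₂ S₃ p₂ p₃)
      ≤-map .tran (_ , M₃ , (M₁ , M₂ , t₁ , t₂ , refl) , t₃ , refl) =
        M₁ ⊗ (M₂ ⊗ M₃) , (M₁ , M₂ ⊗ M₃ , t₁ , (M₂ , M₃ , t₂ , t₃ , refl) , refl) ,
        isImage-byInverse assocˡ′ refl (∈-‖M-assocʳ M₁ M₂ M₃) (∈-‖M-assocˡ M₁ M₂ M₃)

      ≥-map : IsRefinementMap (S₁ ∥ (S₂ ∥ S₃)) ((S₁ ∥ S₂) ∥ S₃) assocˡ′
      ≥-map .init m =
        let p₁ , p₂₃ = ∈-Init-‖⁻ S₁ (S₂ ∥ S₃) m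
            p₂ , p₃  = ∈-Init-‖⁻ S₂ S₃ p₂₃
        in ∈-Init-‖⁺ (S₁ ∥ S₂) S₃ (∈-Init-‖⁺ S₁ S₂ p₁ p₂) p₃
      ≥-map .tran (M₁ , _ , t₁ , (M₂ , M₃ , t₂ , t₃ , refl) , refl) =
        (M₁ ⊗ M₂) ⊗ M₃ , (M₁ ⊗ M₂ , M₃ , (M₁ , M₂ , t₁ , t₂ , refl) , t₃ , refl) ,
        isImage-byInverse assocʳ′ refl (∈-‖M-assocˡ M₁ M₂ M₃) (∈-‖M-assocʳ M₁ M₂ M₃)

  ‖-comm : (S₁ S₂ : NAA n) → _≡m_ n (S₁ ∥ S₂) (S₂ ∥ S₁)
  ‖-comm S₁ S₂ = refinementMap⇒≤m swap (swap-map S₁ S₂) , refinementMap⇒≤m swap (swap-map S₂ S₁)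
    where
      swap-map : (A B : NAA n) → IsRefinementMap (A ∥ B) (B ∥ A) swap
      swap-map A B .init m = let p , q = ∈-Init-‖⁻ A B m in ∈-Init-‖⁺ B A q p
      swap-map A B .tran (M₁ , M₂ , t₁ , t₂ , refl) =
        M₂ ⊗ M₁ , (M₂ , M₁ , t₂ , t₁ , refl) ,
        isImage-byInverse swap refl (∈-‖M-swap M₁ M₂) (∈-‖M-swap M₂ M₁)

  ‖-identityʳ : (S : NAA n) → _≡m_ n (S ∥ U n) S
  ‖-identityʳ S = refinementMap⇒≤m proj₁ ≤-map , refinementMap⇒≤m (_, tt) ≥-map
    where
      ≤-map : IsRefinementMap (S ∥ U n) S proj₁
      ≤-map .init m = proj₁ (∈-Init-‖⁻ S (U n) m)
      ≤-map .tran (M , _ , t , refl , refl) =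
        M , t , isImage-byInverse (_, tt) refl (∈-‖M-U⁻ M) (∈-‖M-U⁺ M)

      ≥-map : IsRefinementMap S (S ∥ U n) (_, tt)
      ≥-map .init m = ∈-Init-‖⁺ S (U n) m (here refl)
      ≥-map .tran {M = M} t =
        M ⊗ succ (U-LTS n) tt , (M , _ , t , refl , refl) ,
        isImage-byInverse proj₁ refl (∈-‖M-U⁺ M) (∈-‖M-U⁻ M)

  module _ {X Y W V : Set} (M₁ : List (Act n × X)) (M₂ : List (Act n × Y))
           {ι : Y → W} {κ : X × Y → V} where

    isImage-‖M-map₂ : {f : X × W → V} → (∀ {x y} → f (x , ι y) ≡ κ (x , y)) →
                      IsImage f (M₁ ⊗ map (map₂ ι) M₂) (map (map₂ κ) (M₁ ⊗ M₂))
    isImage-‖M-map₂ {f} f∘ι≡κ = to , from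
      where
        to : ∀ {a t} → (a , t) ∈ M₁ ⊗ map (map₂ ι) M₂ → (a , f t) ∈ map (map₂ κ) (M₁ ⊗ M₂)
        to m with ∈-‖M⁻ M₁ (map (map₂ ι) M₂) m
        ... | p₁ , p₂ with ∈-map₂⁻ p₂
        ...   | _ , q₂ , refl =
          subst (λ v → (_ , v) ∈ _) (sym f∘ι≡κ) (∈-map⁺ (map₂ κ) (∈-‖M⁺ M₁ M₂ p₁ q₂))

        from : ∀ {a v} → (a , v) ∈ map (map₂ κ) (M₁ ⊗ M₂) →
               ∃[ t ] ((a , t) ∈ M₁ ⊗ map (map₂ ι) M₂ × f t ≡ v)
        from m with ∈-map₂⁻ m
        ... | (x , y) , p , refl =
          let p₁ , p₂ = ∈-‖M⁻ M₁ M₂ p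
          in (x , ι y) , ∈-‖M⁺ M₁ (map (map₂ ι) M₂) p₁ (∈-map⁺ (map₂ ι) p₂) , f∘ι≡κ

    isImage-map₂-‖M : {g : V → X × W} → (∀ {x y} → g (κ (x , y)) ≡ (x , ι y)) →
                      IsImage g (map (map₂ κ) (M₁ ⊗ M₂)) (M₁ ⊗ map (map₂ ι) M₂)
    isImage-map₂-‖M {g} g∘κ≡ι = to , from
      where
        to : ∀ {a v} → (a , v) ∈ map (map₂ κ) (M₁ ⊗ M₂) → (a , g v) ∈ M₁ ⊗ map (map₂ ι) M₂
        to m with ∈-map₂⁻ m
        ... | _ , p , refl =
          let p₁ , p₂ = ∈-‖M⁻ M₁ M₂ p
          in subst (λ t → (_ , t) ∈ _) (sym g∘κ≡ι) (∈-‖M⁺ M₁ (map (map₂ ι) M₂) p₁ (∈-map⁺ (map₂ ι) p₂))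

        from : ∀ {a t} → (a , t) ∈ M₁ ⊗ map (map₂ ι) M₂ →
               ∃[ v ] ((a , v) ∈ map (map₂ κ) (M₁ ⊗ M₂) × g v ≡ t)
        from m with ∈-‖M⁻ M₁ (map (map₂ ι) M₂) m
        ... | p₁ , p₂ with ∈-map₂⁻ p₂
        ...   | _ , q₂ , refl = _ , ∈-map⁺ (map₂ κ) (∈-‖M⁺ M₁ M₂ p₁ q₂) , g∘κ≡ι

  module _ {X Y Z : Set} where

    distribute : X × (Y ⊎ Z) → (X × Y) ⊎ (X × Z)
    distribute (x , inj₁ y) = inj₁ (x , y)
    distribute (x , inj₂ z) = inj₂ (x , z)

    factor : (X × Y) ⊎ (X × Z) → X × (Y ⊎ Z)
    factor (inj₁ (x , y)) = x , inj₁ y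
    factor (inj₂ (x , z)) = x , inj₂ z

  ‖-distribˡ-∨ : (S₁ S₂ S₃ : NAA n) → _≡m_ n (S₁ ∥ (S₂ ⋎ S₃)) ((S₁ ∥ S₂) ⋎ (S₁ ∥ S₃))
  ‖-distribˡ-∨ S₁ S₂ S₃ = refinementMap⇒≤m distribute ≤-map , refinementMap⇒≤m factor ≥-map
    where
      ≤-map : IsRefinementMap (S₁ ∥ (S₂ ⋎ S₃)) ((S₁ ∥ S₂) ⋎ (S₁ ∥ S₃)) distribute
      ≤-map .init {_ , inj₁ _} m =
        let p₁ , p₂ = ∈-Init-‖⁻ S₁ (S₂ ⋎ S₃) m
        in ∈-Init-∨⁺ˡ (S₁ ∥ S₂) (S₁ ∥ S₃) (∈-Init-‖⁺ S₁ S₂ p₁ (∈-Init-∨⁻ˡ S₂ S₃ p₂))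
      ≤-map .init {_ , inj₂ _} m =
        let p₁ , p₃ = ∈-Init-‖⁻ S₁ (S₂ ⋎ S₃) m
        in ∈-Init-∨⁺ʳ (S₁ ∥ S₂) (S₁ ∥ S₃) (∈-Init-‖⁺ S₁ S₃ p₁ (∈-Init-∨⁻ʳ S₂ S₃ p₃))
      ≤-map .tran {_ , inj₁ _} (M₁ , _ , t₁ , (M₂ , t₂ , refl) , refl) =
        map (map₂ inj₁) (M₁ ⊗ M₂) , (M₁ ⊗ M₂ , (M₁ , M₂ , t₁ , t₂ , refl) , refl) ,
        isImage-‖M-map₂ M₁ M₂ refl
      ≤-map .tran {_ , inj₂ _} (M₁ , _ , t₁ , (M₃ , t₃ , refl) , refl) =
        map (map₂ inj₂) (M₁ ⊗ M₃) , (M₁ ⊗ M₃ , (M₁ , M₃ , t₁ , t₃ , refl) , refl) ,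
        isImage-‖M-map₂ M₁ M₃ refl

      ≥-map : IsRefinementMap ((S₁ ∥ S₂) ⋎ (S₁ ∥ S₃)) (S₁ ∥ (S₂ ⋎ S₃)) factor
      ≥-map .init {inj₁ _} m =
        let p₁ , p₂ = ∈-Init-‖⁻ S₁ S₂ (∈-Init-∨⁻ˡ (S₁ ∥ S₂) (S₁ ∥ S₃) m)
        in ∈-Init-‖⁺ S₁ (S₂ ⋎ S₃) p₁ (∈-Init-∨⁺ˡ S₂ S₃ p₂)
      ≥-map .init {inj₂ _} m =
        let p₁ , p₃ = ∈-Init-‖⁻ S₁ S₃ (∈-Init-∨⁻ʳ (S₁ ∥ S₂) (S₁ ∥ S₃) m)
        in ∈-Init-‖⁺ S₁ (S₂ ⋎ S₃) p₁ (∈-Init-∨⁺ʳ S₂ S₃ p₃)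
      ≥-map .tran {inj₁ _} (_ , (M₁ , M₂ , t₁ , t₂ , refl) , refl) =
        M₁ ⊗ map (map₂ inj₁) M₂ , (M₁ , _ , t₁ , (M₂ , t₂ , refl) , refl) ,
        isImage-map₂-‖M M₁ M₂ refl
      ≥-map .tran {inj₂ _} (_ , (M₁ , M₃ , t₁ , t₃ , refl) , refl) =
        M₁ ⊗ map (map₂ inj₂) M₃ , (M₁ , _ , t₁ , (M₃ , t₃ , refl) , refl) ,
        isImage-map₂-‖M M₁ M₃ refl

lemma7 : (n : ℕ) → (S₁ S₂ S₃ S : NAA n)
  → _≡m_ n (_‖_ n (_‖_ n S₁ S₂) S₃) (_‖_ n S₁ (_‖_ n S₂ S₃))
    × _≡m_ n (_‖_ n S₁ S₂) (_‖_ n S₂ S₁)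
    × _≡m_ n (_‖_ n S₁ (_∨_ n S₂ S₃)) (_∨_ n (_‖_ n S₁ S₂) (_‖_ n S₁ S₃))
    × _≡m_ n (_‖_ n S (U n)) S
lemma7 n S₁ S₂ S₃ S = ‖-assoc S₁ S₂ S₃ , ‖-comm S₁ S₂ , ‖-distribˡ-∨ S₁ S₂ S₃ , ‖-identityʳ S
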